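{- For every $p\in\mathrm{OFS}(\mathbb{Z}^+)$, $f(p)\le \min(p)+\max(p)-\gcd(p)$.
   Context: $\mathrm{OFS}(\mathbb{Z}^+)$ denotes the set of all nonempty strictly increasing finite sequences of positive integers. For $p\in\mathrm{OFS}(\mathbb{Z}^+)$, $|p|$ is its length, $p_i$ its $i$-th entry, $\gcd(p)$ the gcd of its entries, $\min(p)=p_1$, $\max(p)=p_{|p|}$. The map $R$ on $\mathrm{OFS}(\mathbb{Z}^+)$: $R(p)=p$ if $|p|=1$; if $n=|p|>1$, form $(p_2-p_1,\ldots,p_n-p_1)$ and, if $p_1$ does not appear in it, insert $p_1$ so that the result is strictly increasing; this is $R(p)$. The function $f:\mathrm{OFS}(\mathbb{Z}^+)\to\mathbb{Z}^+$ is defined recursively by $f(p)=p_1$ if $|p|=1$ and $f(p)=p_1+f(R(p))$ if $|p|>1$. -}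

module Defs where

open import Data.Nat using (ℕ; zero; suc; _+_; _∸_; _<_; _≤_; _<?_; _≟_)
open import Data.Nat.GCD using (gcd)
open import Data.List using (List; []; _∷_; map; foldr)
open import Data.List.Relation.Unary.All using (All)
open import Data.List.Relation.Unary.Linked using (Linked)
open import Relation.Nullary using (yes; no; ¬_)
open import Relation.Binary.PropositionalEquality using (_≡_)

-- OFS(ℤ⁺): nonempty, strictly increasing finite sequences of positive integers,
-- represented as lists of naturals.
record IsOFS (p : List ℕ) : Set where
  field
    nonempty : ¬ (p ≡ [])
    positive : All (0 <_) p
    increasing : Linked _<_ p

-- min p = first entry, max p = last entry (default 0 on [], never used for OFS)
minL : List ℕ → ℕ
minL [] = 0
minL (x ∷ _) = x

maxL : List ℕ → ℕ
maxL [] = 0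
maxL (x ∷ []) = x
maxL (_ ∷ y ∷ ys) = maxL (y ∷ ys)

gcdL : List ℕ → ℕ
gcdL = foldr gcd 0

insert : ℕ → List ℕ → List ℕ
insert x [] = x ∷ []
insert x (y ∷ ys) with x <? y
... | yes _ = x ∷ y ∷ ys
... | no _ with x ≟ y
...   | yes _ = y ∷ ys
...   | no _ = y ∷ insert x ys

R : List ℕ → List ℕ
R [] = []
R (x ∷ []) = x ∷ []
R (x ∷ y ∷ ys) = insert x (map (_∸ x) (y ∷ ys))

-- graph of the recursively defined function f:
-- F p n  means  f(p) = n
data F : List ℕ → ℕ → Set where
  f-single : ∀ x → F (x ∷ []) x
  f-step : ∀ x y ys n → F (R (x ∷ y ∷ ys)) n → F (x ∷ y ∷ ys) (x + n)

module Submission where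

-- We prove the stronger statement: if d divides every entry of
-- p ∈ OFS(ℤ⁺), then f(p) ≤ min(p) + max(p) − d  (the theorem is the case
-- d = gcd(p)).  The proof is by well-founded induction on max(p).
-- For p = (x, y, …, m) with at least two entries, R(p) is obtained by inserting
-- x into the shifted list (y − x, …, m − x).  Hence
--   * R(p) is again in OFS(ℤ⁺) and d still divides all of its entries;
--   * every entry of R(p) is at most max(x, m − x), so max(R(p)) < m;
--   * min(R(p)) ≤ min(x, y − x), and a two-case argument on max(x, m − x)
--     gives min(R(p)) + max(R(p)) ≤ m.
-- Then f(p) = x + f(R(p)) ≤ x + (m − d) = min(p) + max(p) − d.

open import Defs
open import Data.Nat
  using (ℕ; _+_; _∸_; _≤_; _<_; _<?_; _≟_; _⊔_; z≤n; >-nonZero)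
open import Data.Nat.Properties
open import Data.Nat.Induction using (<-wellFounded)
open import Data.Nat.Divisibility using (_∣_; ∣-trans; ∣⇒≤; ∣m+n∣m⇒∣n)
open import Data.Nat.GCD using (gcd; gcd[m,n]∣m; gcd[m,n]∣n)
open import Data.List using (List; []; _∷_; map)
open import Data.List.Relation.Unary.All as All using (All; []; _∷_)
open import Data.List.Relation.Unary.AllPairs using (AllPairs; []; _∷_)
open import Data.List.Relation.Unary.Linked using (Linked; []; [-]; _∷_)
open import Data.List.Relation.Unary.Linked.Properties
  using (Linked⇒All; Linked⇒AllPairs; AllPairs⇒Linked)
open import Data.Product using (Σ; _×_; _,_)
open import Data.Sum using (inj₁; inj₂)
open import Data.Empty using (⊥-elim)
open import Induction.WellFounded using (Acc; acc)
open import Relation.Nullary using (yes; no; ¬_)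
open import Relation.Binary.PropositionalEquality using (_≡_; refl; sym; subst)

insert-nonempty : ∀ x l → ¬ (insert x l ≡ [])
insert-nonempty x [] ()
insert-nonempty x (y ∷ ys) with x <? y
... | yes _ = λ ()
... | no _ with x ≟ y
...   | yes _ = λ ()
...   | no _ = λ ()

insert-all : ∀ {P : ℕ → Set} x l → P x → All P l → All P (insert x l)
insert-all x [] px [] = px ∷ []
insert-all x (y ∷ ys) px (py ∷ pys) with x <? y
... | yes _ = px ∷ py ∷ pys
... | no _ with x ≟ y
...   | yes _ = py ∷ pys
...   | no _ = py ∷ insert-all x ys px pys

-- Insertion preserves strict increase (stated for the pairwise form, where
-- the previous lemma does the work).
insert-sorted : ∀ x l → AllPairs _<_ l → AllPairs _<_ (insert x l)
insert-sorted x [] [] = [] ∷ []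
insert-sorted x (y ∷ ys) (y<ys ∷ sorted) with x <? y
... | yes x<y = (x<y ∷ All.map (<-trans x<y) y<ys) ∷ y<ys ∷ sorted
... | no x≮y with x ≟ y
...   | yes _ = y<ys ∷ sorted
...   | no x≢y = insert-all x ys y<x y<ys ∷ insert-sorted x ys sorted
  where
  y<x : y < x
  y<x = ≤∧≢⇒< (≮⇒≥ x≮y) (λ y≡x → x≢y (sym y≡x))

insert-increasing : ∀ x l → Linked _<_ l → Linked _<_ (insert x l)
insert-increasing x l inc =
  AllPairs⇒Linked (insert-sorted x l (Linked⇒AllPairs <-trans inc))

insert-min≤new : ∀ x l → minL (insert x l) ≤ x
insert-min≤new x [] = ≤-refl
insert-min≤new x (y ∷ ys) with x <? y
... | yes _ = ≤-refl
... | no x≮y with x ≟ y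
...   | yes x≡y = ≤-reflexive (sym x≡y)
...   | no _ = ≮⇒≥ x≮y

insert-min≤head : ∀ x y ys → minL (insert x (y ∷ ys)) ≤ y
insert-min≤head x y ys with x <? y
... | yes x<y = <⇒≤ x<y
... | no _ with x ≟ y
...   | yes _ = ≤-refl
...   | no _ = ≤-refl

maxL-bounded : ∀ {b} l → All (_≤ b) l → maxL l ≤ b
maxL-bounded [] [] = z≤n
maxL-bounded (x ∷ []) (x≤b ∷ []) = x≤b
maxL-bounded (x ∷ y ∷ ys) (_ ∷ bounded) = maxL-bounded (y ∷ ys) bounded

entries≤maxL : ∀ {l} → Linked _<_ l → All (_≤ maxL l) l
entries≤maxL [] = []
entries≤maxL [-] = ≤-refl ∷ []
entries≤maxL (x<y ∷ inc) with entries≤maxL inc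
... | y≤max ∷ rest = ≤-trans (<⇒≤ x<y) y≤max ∷ y≤max ∷ rest

gcdL-divides : ∀ l → All (gcdL l ∣_) l
gcdL-divides [] = []
gcdL-divides (x ∷ xs) =
  gcd[m,n]∣m x (gcdL xs) ∷ All.map (∣-trans (gcd[m,n]∣n x (gcdL xs))) (gcdL-divides xs)

divisor≤ : ∀ {d x} → 0 < x → d ∣ x → d ≤ x
divisor≤ 0<x d∣x = ∣⇒≤ {{>-nonZero 0<x}} d∣x

∣-∸ : ∀ {d x y} → x ≤ y → d ∣ x → d ∣ y → d ∣ y ∸ x
∣-∸ {d} x≤y d∣x d∣y = ∣m+n∣m⇒∣n (subst (d ∣_) (sym (m+[n∸m]≡n x≤y)) d∣y) d∣x

shift : ℕ → List ℕ → List ℕ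
shift c = map (_∸ c)

shift-all : ∀ {P : ℕ → Set} c {l} → All (λ z → P (z ∸ c)) l → All P (shift c l)
shift-all c [] = []
shift-all c (pz ∷ pzs) = pz ∷ shift-all c pzs

shift-increasing : ∀ c {l} → All (c <_) l → Linked _<_ l → Linked _<_ (shift c l)
shift-increasing c _ [] = []
shift-increasing c _ [-] = [-]
shift-increasing c (c<y ∷ c<l) (y<z ∷ inc) =
  ∸-monoˡ-< y<z (<⇒≤ c<y) ∷ shift-increasing c c<l inc

module _ {x y : ℕ} {ys : List ℕ} (ofs : IsOFS (x ∷ y ∷ ys)) where
  open IsOFS ofs

  private
    tail = y ∷ ys
    m = maxL tail
    Rp = R (x ∷ tail)

    0<x : 0 < x
    0<x with positive
    ... | 0<x ∷ _ = 0<x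

    x<tail : All (x <_) tail
    x<tail with increasing
    ... | x<y ∷ inc = Linked⇒All <-trans x<y inc

    tail-increasing : Linked _<_ tail
    tail-increasing with increasing
    ... | _ ∷ inc = inc

    tail≤m : All (_≤ m) tail
    tail≤m = entries≤maxL tail-increasing

    x<y : x < y
    x<y with x<tail
    ... | x<y ∷ _ = x<y

    y≤m : y ≤ m
    y≤m with tail≤m
    ... | y≤m ∷ _ = y≤m

    x<m : x < m
    x<m = <-≤-trans x<y y≤m

    maxR≤ : maxL Rp ≤ x ⊔ (m ∸ x)
    maxR≤ = maxL-bounded Rp (insert-all x (shift x tail) (m≤m⊔n x _)
              (shift-all x (All.map (λ z≤m → ≤-trans (∸-monoˡ-≤ x z≤m) (m≤n⊔m x _)) tail≤m)))

  R-isOFS : IsOFS Rp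
  R-isOFS = record
    { nonempty = insert-nonempty x (shift x tail)
    ; positive = insert-all x (shift x tail) 0<x (shift-all x (All.map m<n⇒0<n∸m x<tail))
    ; increasing = insert-increasing x (shift x tail) (shift-increasing x x<tail tail-increasing)
    }

  R-divisible : ∀ {d} → All (d ∣_) (x ∷ tail) → All (d ∣_) Rp
  R-divisible (d∣x ∷ d∣tail) = insert-all x (shift x tail) d∣x
    (shift-all x (All.zipWith (λ { (x<z , d∣z) → ∣-∸ (<⇒≤ x<z) d∣x d∣z }) (x<tail , d∣tail)))

  -- R strictly decreases the maximum: max(x, m − x) < m since 0 < x < m.
  R-max< : maxL Rp < m
  R-max< = ≤-<-trans maxR≤ (⊔-lub x<m (∸-monoʳ-< 0<x (<⇒≤ x<m)))

  -- min(R p) + max(R p) ≤ max p, using min(R p) ≤ min(x, y − x).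
  R-min+max≤ : minL Rp + maxL Rp ≤ m
  R-min+max≤ with ≤-total x (m ∸ x)
  ... | inj₁ x≤m-x = begin
        minL Rp + maxL Rp  ≤⟨ +-mono-≤ (insert-min≤new x (shift x tail))
                                         (≤-trans maxR≤ (≤-reflexive (m≤n⇒m⊔n≡n x≤m-x))) ⟩
        x + (m ∸ x)        ≡⟨ m+[n∸m]≡n (<⇒≤ x<m) ⟩
        m                  ∎
    where open ≤-Reasoning
  ... | inj₂ m-x≤x = begin
        minL Rp + maxL Rp  ≤⟨ +-mono-≤ (insert-min≤head x (y ∸ x) (shift x ys))
                                         (≤-trans maxR≤ (≤-reflexive (m≥n⇒m⊔n≡m m-x≤x))) ⟩
        (y ∸ x) + x        ≡⟨ m∸n+n≡m (<⇒≤ x<y) ⟩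
        y                  ≤⟨ y≤m ⟩
        m                  ∎
    where open ≤-Reasoning

  divisor≤max : ∀ {d} → All (d ∣_) (x ∷ tail) → d ≤ m
  divisor≤max (d∣x ∷ _) = ≤-trans (divisor≤ 0<x d∣x) (<⇒≤ x<m)

f-bound-acc : ∀ d p → Acc _<_ (maxL p) → IsOFS p → All (d ∣_) p →
  Σ ℕ (λ n → F p n × n ≤ (minL p + maxL p) ∸ d)
f-bound-acc d [] _ ofs _ = ⊥-elim (IsOFS.nonempty ofs refl)
f-bound-acc d (x ∷ []) _ ofs (d∣x ∷ []) with IsOFS.positive ofs
... | 0<x ∷ [] = x , f-single x , subst (x ≤_) (sym (+-∸-assoc x d≤x)) (m≤m+n x (x ∸ d))
  where
  d≤x : d ≤ x
  d≤x = divisor≤ 0<x d∣x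
f-bound-acc d (x ∷ y ∷ ys) (acc smaller) ofs d∣p
  with f-bound-acc d (R (x ∷ y ∷ ys)) (smaller (R-max< ofs)) (R-isOFS ofs) (R-divisible ofs d∣p)
... | n , fRp≡n , n≤ = x + n , f-step x y ys n fRp≡n , bound
  where
  m = maxL (y ∷ ys)
  open ≤-Reasoning
  bound : x + n ≤ (x + m) ∸ d
  bound = begin
    x + n        ≤⟨ +-monoʳ-≤ x (≤-trans n≤ (∸-monoˡ-≤ d (R-min+max≤ ofs))) ⟩
    x + (m ∸ d)  ≡⟨ +-∸-assoc x (divisor≤max ofs d∣p) ⟨
    (x + m) ∸ d  ∎

proposition15 : (p : List ℕ) → IsOFS p →
    Σ ℕ (λ n → F p n × n ≤ (minL p + maxL p) ∸ gcdL p)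
proposition15 p ofs = f-bound-acc (gcdL p) p (<-wellFounded (maxL p)) ofs (gcdL-divides p)
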